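{- Let $k\ge 0$ be an integer, let $p_1,\dots,p_k$ be distinct primes, and let $\Gamma_k$ be the $k$-dprime divisor function graph of $n=p_1p_2\cdots p_k$. Then the Wiener index of $\Gamma_k$ is $$W(\Gamma_k)=2^{2k}-3^k.$$
   Context: For $n=p_1p_2\cdots p_k$ with $p_1,\dots,p_k$ distinct primes, the $k$-dprime divisor function graph $\Gamma_k=G_{D(n)}$ is the simple graph with vertex set $V(\Gamma_k)=\{u\in\mathbb{Z}_{>0}: u\mid n\}$ and edge set $E(\Gamma_k)=\{uv: u\neq v,\ u\mid v \text{ or } v\mid u\}$. The Wiener index is $W(\Gamma_k)=\sum_{\{u,v\}\subseteq V(\Gamma_k)} d_{\Gamma_k}(u,v)$, summed over unordered pairs of distinct vertices, where $d_{\Gamma_k}$ is the shortest-path distance. -}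

module Defs where

open import Data.Nat using (ℕ; zero; suc; _+_; _*_; _≡ᵇ_)
open import Data.Nat.Divisibility using (_∣?_)
open import Data.Bool using (Bool; true; false; _∧_; _∨_; not; if_then_else_)
open import Data.List using (List; []; _∷_; map; _++_; filter; length; upTo)
open import Data.Bool.ListAction using (any)
open import Data.Nat.ListAction using (sum)
open import Data.Fin using (Fin; zero; suc)
open import Data.Product using (_×_; _,_)
open import Relation.Nullary.Decidable using (⌊_⌋)

prodFin : ∀ {k} → (Fin k → ℕ) → ℕ
prodFin {zero}  p = 1
prodFin {suc k} p = p zero * prodFin (λ i → p (suc i))

-- A finite simple graph on natural-number vertices: a duplicate-free vertex
-- list and a Boolean adjacency relation.
record Graph : Set where
  field
    V   : List ℕ
    adj : ℕ → ℕ → Bool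
open Graph public

walk : Graph → ℕ → ℕ → ℕ → Bool
walk G zero    u v = u ≡ᵇ v
walk G (suc d) u v = any (λ w → adj G u w ∧ walk G d w v) (V G)

-- least d in [start, start+fuel) with P d (fallback: start+fuel)
leastFrom : (ℕ → Bool) → ℕ → ℕ → ℕ
leastFrom P d zero    = d
leastFrom P d (suc f) = if P d then d else leastFrom P (suc d) f

-- Shortest-path distance: the least length of a walk from u to v.
-- (Any shortest walk has length < |V|; for a disconnected pair the value is
-- an irrelevant fallback |V|.)
dist : Graph → ℕ → ℕ → ℕ
dist G u v = leastFrom (λ d → walk G d u v) 0 (length (V G))

pairs : {A : Set} → List A → List (A × A)
pairs []       = []
pairs (x ∷ xs) = map (x ,_) xs ++ pairs xs

wiener : Graph → ℕ
wiener G = sum (map (λ { (u , v) → dist G u v }) (pairs (V G)))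

divisors : ℕ → List ℕ
divisors n = filter (λ u → u ∣? n) (upTo (suc n))
  -- upTo (suc n) = [0 … n]; 0 ∤ n for n ≥ 1, so 0 is excluded.

divisorGraph : ℕ → Graph
divisorGraph n = record
  { V   = divisors n
  ; adj = λ u v → not (u ≡ᵇ v) ∧ (⌊ u ∣? v ⌋ ∨ ⌊ v ∣? u ⌋) }

-- Any two divisors of n are joined by a path of length at most 2 through the
-- vertex 1, and they are adjacent exactly when one divides the other.  Hence
-- d(u, v) + [u ∣ v] + [v ∣ u] = 2 for distinct divisors u, v, and summing over
-- all pairs gives W + S = |D|², where D is the set of divisors and S counts the
-- ordered pairs (u, v) ∈ D² with u ∣ v.  For a product of k distinct primes,
-- |D| = 2ᵏ and S = 3ᵏ: adjoining a new prime p splits every divisor pair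
-- u ∣ v into the three pairs u ∣ v, u ∣ pv and pu ∣ pv, while pu ∤ v.
module Submission where

open import Defs
open import Data.Bool using (Bool; true; false; T; _∧_)
open import Data.Bool.ListAction using (any)
open import Data.Bool.Properties using (T-∧; T-∨)
open import Data.Empty using (⊥-elim)
open import Data.Fin using (Fin; zero; suc)
import Data.Fin.Properties as Fin
open import Data.Integer as ℤ using (_-_; _⊖_)
open import Data.Integer.Properties using (m-n≡m⊖n; ⊖-≥)
open import Data.List using (List; []; _∷_; map; _++_; length; upTo)
open import Data.List.Properties using (map-++; map-∘; map-cong-local; length-++; length-map)
open import Data.List.Membership.Propositional using (_∈_; find; lose)
open import Data.List.Membership.Propositional.Properties
  using (∈-++⁻; ∈-++⁺ˡ; ∈-++⁺ʳ; ∈-map⁻; ∈-map⁺; ∈-filter⁻; ∈-filter⁺; ∈-upTo⁺)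
open import Data.List.Membership.Propositional.Properties.WithK using (unique∧set⇒bag)
open import Data.List.Relation.Binary.BagAndSetEquality using (∼bag⇒↭)
open import Data.List.Relation.Binary.Permutation.Propositional using (_↭_)
import Data.List.Relation.Binary.Permutation.Propositional.Properties as ↭
import Data.List.Relation.Unary.All as All
open import Data.List.Relation.Unary.Any using (here; there)
open import Data.List.Relation.Unary.Any.Properties using (any⁺; any⁻)
open import Data.List.Relation.Unary.Unique.Propositional using (Unique; _∷_)
import Data.List.Relation.Unary.Unique.Propositional.Properties as Unique
open import Data.Nat
open import Data.Nat.Coprimality using (Coprime; coprime-divisor)
open import Data.Nat.Divisibility
open import Data.Nat.ListAction using (sum)
open import Data.Nat.ListAction.Properties using (sum-++; sum-↭)
open import Data.Nat.Primality using (Prime; ¬prime[1]; prime⇒nonZero; prime⇒irreducible; euclidsLemma)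
open import Data.Nat.Properties
open import Algebra.Properties.CommutativeSemigroup +-commutativeSemigroup
  using () renaming (interchange to +-interchange)
open import Data.Nat.Tactic.RingSolver using (solve-∀)
open import Data.Product using (_×_; _,_; ∃; proj₂; uncurry)
open import Data.Sum as Sum using (_⊎_; inj₁; inj₂)
open import Function using (_∘_; flip; _⇔_; mk⇔; Equivalence)
open import Relation.Nullary using (¬_; Dec; yes; no; contradiction)
open import Relation.Nullary.Decidable using (fromWitness; toWitness)
open import Relation.Binary.PropositionalEquality

private
  variable
    A B : Set

∑ : List A → (A → ℕ) → ℕ
∑ xs f = sum (map f xs)

syntax ∑ xs (λ x → e) = ∑[ x ∈ xs ] e

∑-++ : ∀ xs ys (f : A → ℕ) → ∑ (xs ++ ys) f ≡ ∑ xs f + ∑ ys f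
∑-++ xs ys f = trans (cong sum (map-++ f xs ys)) (sum-++ (map f xs) (map f ys))

∑-map : (g : B → A) (xs : List B) (f : A → ℕ) → ∑ (map g xs) f ≡ ∑ xs (f ∘ g)
∑-map g xs f = cong sum (sym (map-∘ xs))

∑-+ : ∀ xs (f g : A → ℕ) → ∑[ x ∈ xs ] (f x + g x) ≡ ∑ xs f + ∑ xs g
∑-+ []       f g = refl
∑-+ (x ∷ xs) f g = trans (cong (f x + g x +_) (∑-+ xs f g)) (+-interchange (f x) (g x) (∑ xs f) (∑ xs g))

∑-cong : ∀ (xs : List A) {f g : A → ℕ} → (∀ {x} → x ∈ xs → f x ≡ g x) → ∑ xs f ≡ ∑ xs g
∑-cong xs f≗g = cong sum (map-cong-local (All.tabulate f≗g))

∑-const : ∀ (xs : List A) n → ∑[ _ ∈ xs ] n ≡ length xs * n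
∑-const []       n = refl
∑-const (x ∷ xs) n = cong (n +_) (∑-const xs n)

∑-↭ : ∀ {xs ys} → xs ↭ ys → (f : A → ℕ) → ∑ xs f ≡ ∑ ys f
∑-↭ xs↭ys f = sum-↭ (↭.map⁺ f xs↭ys)

∑-pairs : ∀ {A : Set} (xs : List A) (f : A → A → ℕ) →
  ∑ (pairs xs) (uncurry λ u v → f u v + f v u) + ∑[ u ∈ xs ] f u u ≡ ∑[ u ∈ xs ] ∑ xs (f u)
∑-pairs []       f = refl
∑-pairs {A} (x ∷ xs) f = begin
  ∑ (map (x ,_) xs ++ pairs xs) g + (f x x + Δ)
    ≡⟨ cong (_+ (f x x + Δ)) (∑-++ (map (x ,_) xs) (pairs xs) g) ⟩
  ∑ (map (x ,_) xs) g + P + (f x x + Δ)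
    ≡⟨ cong (λ z → z + P + (f x x + Δ)) (trans (∑-map (x ,_) xs g) (∑-+ xs (f x) (λ v → f v x))) ⟩
  ∑ xs (f x) + ∑[ v ∈ xs ] f v x + P + (f x x + Δ)
    ≡⟨ rearrange (∑ xs (f x)) (∑[ v ∈ xs ] f v x) P (f x x) Δ ⟩
  f x x + ∑ xs (f x) + (∑[ v ∈ xs ] f v x + (P + Δ))
    ≡⟨ cong (λ z → f x x + ∑ xs (f x) + (∑[ v ∈ xs ] f v x + z)) (∑-pairs xs f) ⟩
  f x x + ∑ xs (f x) + (∑[ v ∈ xs ] f v x + ∑[ u ∈ xs ] ∑ xs (f u))
    ≡⟨ cong (f x x + ∑ xs (f x) +_) (∑-+ xs (λ v → f v x) (λ u → ∑ xs (f u))) ⟨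
  ∑[ u ∈ x ∷ xs ] ∑ (x ∷ xs) (f u)
    ∎
  where
  open ≡-Reasoning
  g : A × A → ℕ
  g = uncurry λ u v → f u v + f v u
  P : ℕ
  P = ∑ (pairs xs) g
  Δ : ℕ
  Δ = ∑[ u ∈ xs ] f u u
  rearrange : ∀ a b c d e → a + b + c + (d + e) ≡ d + a + (b + (c + e))
  rearrange = solve-∀

∈-pairs⁻ : ∀ {xs} {u v : A} → Unique xs → (u , v) ∈ pairs xs → u ∈ xs × v ∈ xs × u ≢ v
∈-pairs⁻ {xs = x ∷ xs} (x∉xs ∷ uxs) uv∈ with ∈-++⁻ (map (x ,_) xs) uv∈
... | inj₁ uv∈xxs with ∈-map⁻ (x ,_) uv∈xxs
...   | v , v∈xs , refl = here refl , there v∈xs , All.lookup x∉xs v∈xs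
∈-pairs⁻ {xs = x ∷ xs} (_ ∷ uxs) uv∈ | inj₂ uv∈pairs with ∈-pairs⁻ uxs uv∈pairs
...   | u∈xs , v∈xs , u≢v = there u∈xs , there v∈xs , u≢v

length≥2 : {u v : A} {xs : List A} → u ∈ xs → v ∈ xs → u ≢ v → 2 ≤ length xs
length≥2 (here refl) (here refl) u≢v = contradiction refl u≢v
length≥2 {xs = _ ∷ _ ∷ _} (here refl) (there _) _ = s≤s (s≤s z≤n)
length≥2 {xs = _ ∷ _ ∷ _} (there _)   _         _ = s≤s (s≤s z≤n)
length≥2 {xs = _ ∷ []}    (here refl) (there ())
length≥2 {xs = _ ∷ []}    (there ())

leastFrom≡1 : ∀ (P : ℕ → Bool) {n} → 2 ≤ n → ¬ T (P 0) → T (P 1) → leastFrom P 0 n ≡ 1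
leastFrom≡1 P {1} (s≤s ())
leastFrom≡1 P {suc (suc n)} _ ¬P0 P1 with P 0 | P 1
... | false | true  = refl
... | true  | _     = contradiction _ ¬P0
... | false | false = ⊥-elim P1

leastFrom≡2 : ∀ (P : ℕ → Bool) {n} → 2 ≤ n → ¬ T (P 0) → ¬ T (P 1) → T (P 2) → leastFrom P 0 n ≡ 2
leastFrom≡2 P {1} (s≤s ())
leastFrom≡2 P {suc (suc n)} _ ¬P0 ¬P1 P2 with P 0 | P 1
... | true  | _     = contradiction _ ¬P0
... | false | true  = contradiction _ ¬P1
leastFrom≡2 P {2}                 _ _ _ _  | false | false = refl
leastFrom≡2 P {suc (suc (suc n))} _ _ _ P2 | false | false with P 2
... | true = refl

module _ (G : Graph) where

  T-walk-suc : ∀ {d u v} → T (walk G (suc d) u v) ⇔ (∃ λ w → w ∈ V G × T (adj G u w) × T (walk G d w v))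
  T-walk-suc {d} {u} {v} = mk⇔ to from
    where
    step : ℕ → Bool
    step w = adj G u w ∧ walk G d w v
    to : T (any step (V G)) → ∃ λ w → w ∈ V G × T (adj G u w) × T (walk G d w v)
    to t with find (any⁻ step (V G) t)
    ... | w , w∈V , uw∧wv = w , w∈V , Equivalence.to T-∧ uw∧wv
    from : (∃ λ w → w ∈ V G × T (adj G u w) × T (walk G d w v)) → T (any step (V G))
    from (w , w∈V , uw , wv) = any⁺ step (lose w∈V (Equivalence.from T-∧ (uw , wv)))

  walk-1 : ∀ {u v} → v ∈ V G → T (adj G u v) → T (walk G 1 u v)
  walk-1 {u} {v} v∈V uv = Equivalence.from (T-walk-suc {0} {u} {v}) (v , v∈V , uv , ≡⇒≡ᵇ v v refl)

  dist≡1 : ∀ {u v} → u ∈ V G → v ∈ V G → u ≢ v → T (adj G u v) → dist G u v ≡ 1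
  dist≡1 {u} {v} u∈V v∈V u≢v uv =
    leastFrom≡1 (λ d → walk G d u v) (length≥2 u∈V v∈V u≢v) (u≢v ∘ ≡ᵇ⇒≡ u v) (walk-1 v∈V uv)

  dist≡2 : ∀ {u w v} → u ∈ V G → w ∈ V G → v ∈ V G → u ≢ v → ¬ T (adj G u v) →
    T (adj G u w) → T (adj G w v) → dist G u v ≡ 2
  dist≡2 {u} {w} {v} u∈V w∈V v∈V u≢v ¬uv uw wv =
    leastFrom≡2 (λ d → walk G d u v) (length≥2 u∈V v∈V u≢v) (u≢v ∘ ≡ᵇ⇒≡ u v) ¬walk-1
      (Equivalence.from (T-walk-suc {1} {u} {v}) (w , w∈V , uw , walk-1 v∈V wv))
    where
    ¬walk-1 : ¬ T (walk G 1 u v)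
    ¬walk-1 t with Equivalence.to (T-walk-suc {0} {u} {v}) t
    ... | w′ , _ , uw′ , w′≡v = ¬uv (subst (T ∘ adj G u) (≡ᵇ⇒≡ w′ v w′≡v) uw′)

𝟙 : {P : Set} → Dec P → ℕ
𝟙 (yes _) = 1
𝟙 (no _)  = 0

𝟙-yes : {P : Set} → P → (p? : Dec P) → 𝟙 p? ≡ 1
𝟙-yes p (yes _) = refl
𝟙-yes p (no ¬p) = contradiction p ¬p

𝟙-no : {P : Set} → ¬ P → (p? : Dec P) → 𝟙 p? ≡ 0
𝟙-no ¬p (yes p) = contradiction p ¬p
𝟙-no ¬p (no _)  = refl

𝟙-⇔ : {P Q : Set} → P ⇔ Q → (p? : Dec P) (q? : Dec Q) → 𝟙 p? ≡ 𝟙 q?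
𝟙-⇔ P⇔Q (yes p) q? = sym (𝟙-yes (Equivalence.to P⇔Q p) q?)
𝟙-⇔ P⇔Q (no ¬p) q? = sym (𝟙-no (¬p ∘ Equivalence.from P⇔Q) q?)

∈-divisors⁺ : ∀ {N d} .{{_ : NonZero N}} → d ∣ N → d ∈ divisors N
∈-divisors⁺ {N} d∣N = ∈-filter⁺ (_∣? N) (∈-upTo⁺ (s≤s (∣⇒≤ d∣N))) d∣N

∈-divisors⁻ : ∀ {N d} → d ∈ divisors N → d ∣ N
∈-divisors⁻ {N} d∈ = proj₂ (∈-filter⁻ (_∣? N) {xs = upTo (suc N)} d∈)

divisors-unique : ∀ N → Unique (divisors N)
divisors-unique N = Unique.filter⁺ (_∣? N) (Unique.upTo⁺ (suc N))

dividingPairs : ℕ → ℕ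
dividingPairs N = ∑[ u ∈ divisors N ] ∑[ v ∈ divisors N ] 𝟙 (u ∣? v)

T-adj-divisorGraph : ∀ {N u v} → u ≢ v → T (adj (divisorGraph N) u v) ⇔ (u ∣ v ⊎ v ∣ u)
T-adj-divisorGraph {N} {u} {v} u≢v with u ≡ᵇ v in u≡ᵇv
... | true  = contradiction (≡ᵇ⇒≡ u v (subst T (sym u≡ᵇv) _)) u≢v
... | false = mk⇔ (Sum.map (toWitness {a? = u ∣? v}) (toWitness {a? = v ∣? u}) ∘ Equivalence.to T-∨)
                  (Equivalence.from T-∨ ∘ Sum.map (fromWitness {a? = u ∣? v}) (fromWitness {a? = v ∣? u}))

dist-divisorGraph : ∀ {N} .{{_ : NonZero N}} {u v} → u ∣ N → v ∣ N → u ≢ v →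
  dist (divisorGraph N) u v + 𝟙 (u ∣? v) + 𝟙 (v ∣? u) ≡ 2
dist-divisorGraph {N} {u} {v} u∣N v∣N u≢v = by-cases (u ∣? v) (v ∣? u)
  where
  G : Graph
  G = divisorGraph N
  u∈ : u ∈ divisors N
  u∈ = ∈-divisors⁺ u∣N
  v∈ : v ∈ divisors N
  v∈ = ∈-divisors⁺ v∣N
  adjacent : ∀ {x y} → x ≢ y → x ∣ y ⊎ y ∣ x → T (adj G x y)
  adjacent x≢y = Equivalence.from (T-adj-divisorGraph {N} x≢y)
  by-cases : (u∣?v : Dec (u ∣ v)) (v∣?u : Dec (v ∣ u)) → dist G u v + 𝟙 u∣?v + 𝟙 v∣?u ≡ 2
  by-cases (yes u∣v) (yes v∣u) = contradiction (∣-antisym u∣v v∣u) u≢v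
  by-cases (yes u∣v) (no _)    = cong (λ d → d + 1 + 0) (dist≡1 G u∈ v∈ u≢v (adjacent u≢v (inj₁ u∣v)))
  by-cases (no _)    (yes v∣u) = cong (λ d → d + 0 + 1) (dist≡1 G u∈ v∈ u≢v (adjacent u≢v (inj₂ v∣u)))
  by-cases (no u∤v)  (no v∤u)  = cong (λ d → d + 0 + 0)
    (dist≡2 G u∈ (∈-divisors⁺ (1∣ N)) v∈ u≢v
      (Sum.[ u∤v , v∤u ] ∘ Equivalence.to (T-adj-divisorGraph {N} u≢v))
      (adjacent (λ u≡1 → u∤v (subst (_∣ v) (sym u≡1) (1∣ v))) (inj₂ (1∣ u)))
      (adjacent (λ 1≡v → v∤u (subst (_∣ u) 1≡v (1∣ u))) (inj₁ (1∣ v))))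

wiener+dividingPairs : ∀ N .{{_ : NonZero N}} →
  wiener (divisorGraph N) + dividingPairs N ≡ length (divisors N) * length (divisors N)
wiener+dividingPairs N = begin
  W + dividingPairs N
    ≡⟨ cong (W +_) (sym (∑-pairs D c)) ⟩
  W + (∑ (pairs D) (uncurry λ u v → c u v + c v u) + ∑[ u ∈ D ] c u u)
    ≡⟨ sym (+-assoc W _ _) ⟩
  W + ∑ (pairs D) (uncurry λ u v → c u v + c v u) + ∑[ u ∈ D ] c u u
    ≡⟨ cong₂ _+_ (sym (∑-+ (pairs D) (uncurry (dist G)) (uncurry λ u v → c u v + c v u)))
                 (∑-cong D λ {u} _ → 𝟙-yes ∣-refl (u ∣? u)) ⟩
  ∑ (pairs D) (uncurry λ u v → dist G u v + (c u v + c v u)) + ∑[ _ ∈ D ] 1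
    ≡⟨ cong (_+ ∑[ _ ∈ D ] 1) (∑-cong (pairs D) distance-two) ⟩
  ∑ (pairs D) (uncurry λ _ _ → 1 + 1) + ∑[ _ ∈ D ] 1
    ≡⟨ ∑-pairs D (λ _ _ → 1) ⟩
  ∑[ _ ∈ D ] ∑[ _ ∈ D ] 1
    ≡⟨ trans (∑-const D (∑[ _ ∈ D ] 1)) (cong (length D *_) (trans (∑-const D 1) (*-identityʳ _))) ⟩
  length D * length D
    ∎
  where
  open ≡-Reasoning
  G : Graph
  G = divisorGraph N
  D : List ℕ
  D = divisors N
  W : ℕ
  W = wiener G
  c : ℕ → ℕ → ℕ
  c u v = 𝟙 (u ∣? v)
  distance-two : ∀ {uv} → uv ∈ pairs D → uncurry (λ u v → dist G u v + (c u v + c v u)) uv ≡ 2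
  distance-two {u , v} uv∈ with ∈-pairs⁻ (divisors-unique N) uv∈
  ... | u∈ , v∈ , u≢v = trans (sym (+-assoc _ (c u v) (c v u)))
                              (dist-divisorGraph (∈-divisors⁻ u∈) (∈-divisors⁻ v∈) u≢v)

prime∤⇒coprime : ∀ {p u} → Prime p → ¬ p ∣ u → Coprime u p
prime∤⇒coprime p-prime p∤u (d∣u , d∣p) with prime⇒irreducible p-prime d∣p
... | inj₁ d≡1 = d≡1
... | inj₂ refl = contradiction d∣u p∤u

∣*⇔∣ : ∀ {p u v} → Prime p → ¬ p ∣ u → u ∣ p * v ⇔ u ∣ v
∣*⇔∣ {p} p-prime p∤u = mk⇔ (coprime-divisor (prime∤⇒coprime p-prime p∤u)) (∣n⇒∣m*n p)

module _ {p m} (p-prime : Prime p) .{{_ : NonZero m}} (p∤m : ¬ p ∣ m) where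

  private
    instance
      p≢0 : NonZero p
      p≢0 = prime⇒nonZero p-prime
      p*m≢0 : NonZero (p * m)
      p*m≢0 = m*n≢0 p m

    D : List ℕ
    D = divisors m

  divisors-*-prime : divisors (p * m) ↭ D ++ map (p *_) D
  divisors-*-prime = ∼bag⇒↭ (unique∧set⇒bag (divisors-unique (p * m)) unique (mk⇔ split merge))
    where
    split : ∀ {x} → x ∈ divisors (p * m) → x ∈ D ++ map (p *_) D
    split {x} x∈ with p ∣? x
    ... | no p∤x = ∈-++⁺ˡ (∈-divisors⁺ (Equivalence.to (∣*⇔∣ p-prime p∤x) (∈-divisors⁻ x∈)))
    ... | yes (divides q refl) rewrite *-comm q p =
      ∈-++⁺ʳ D (∈-map⁺ (p *_) (∈-divisors⁺ (*-cancelˡ-∣ p (∈-divisors⁻ x∈))))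
    merge : ∀ {x} → x ∈ D ++ map (p *_) D → x ∈ divisors (p * m)
    merge x∈ with ∈-++⁻ D x∈
    ... | inj₁ x∈D = ∈-divisors⁺ (∣n⇒∣m*n p (∈-divisors⁻ x∈D))
    ... | inj₂ x∈pD with ∈-map⁻ (p *_) x∈pD
    ...   | y , y∈D , refl = ∈-divisors⁺ (*-monoʳ-∣ p (∈-divisors⁻ y∈D))
    disjoint : ∀ {x} → ¬ (x ∈ D × x ∈ map (p *_) D)
    disjoint (x∈D , x∈pD) with ∈-map⁻ (p *_) x∈pD
    ... | y , _ , refl = p∤m (∣-trans (m∣m*n y) (∈-divisors⁻ x∈D))
    unique : Unique (D ++ map (p *_) D)
    unique = Unique.++⁺ (divisors-unique m)
      (Unique.map⁺ (λ {x} {y} → *-cancelˡ-≡ x y p) (divisors-unique m)) disjoint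

  length-divisors-*-prime : length (divisors (p * m)) ≡ 2 * length D
  length-divisors-*-prime = begin
    length (divisors (p * m))        ≡⟨ ↭.↭-length divisors-*-prime ⟩
    length (D ++ map (p *_) D)       ≡⟨ length-++ D ⟩
    length D + length (map (p *_) D) ≡⟨ cong (length D +_) (length-map (p *_) D) ⟩
    length D + length D              ≡⟨ cong (length D +_) (+-identityʳ (length D)) ⟨
    2 * length D                     ∎
    where open ≡-Reasoning

  dividingPairs-*-prime : dividingPairs (p * m) ≡ 3 * dividingPairs m
  dividingPairs-*-prime = begin
    dividingPairs (p * m)
      ≡⟨ ∑-cong (divisors (p * m)) (λ {u} _ → ∑-↭ divisors-*-prime (λ v → 𝟙 (u ∣? v))) ⟩
    ∑[ u ∈ divisors (p * m) ] ∑[ v ∈ R ] 𝟙 (u ∣? v)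
      ≡⟨ ∑-↭ divisors-*-prime _ ⟩
    ∑[ u ∈ R ] ∑[ v ∈ R ] 𝟙 (u ∣? v)
      ≡⟨ ∑-R _ ⟩
    ∑[ u ∈ D ] ∑[ v ∈ R ] 𝟙 (u ∣? v) + ∑[ u ∈ D ] ∑[ v ∈ R ] 𝟙 (p * u ∣? v)
      ≡⟨ cong₂ _+_ (∑-cong D row-u) (∑-cong D row-pu) ⟩
    ∑[ u ∈ D ] (S u + S u) + ∑ D S
      ≡⟨ cong (_+ ∑ D S) (∑-+ D S S) ⟩
    ∑ D S + ∑ D S + ∑ D S
      ≡⟨ x+x+x≡3*x (∑ D S) ⟩
    3 * dividingPairs m
      ∎
    where
    open ≡-Reasoning
    R : List ℕ
    R = D ++ map (p *_) D
    S : ℕ → ℕ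
    S u = ∑[ v ∈ D ] 𝟙 (u ∣? v)
    ∑-R : ∀ f → ∑ R f ≡ ∑ D f + ∑[ v ∈ D ] f (p * v)
    ∑-R f = trans (∑-++ D (map (p *_) D) f) (cong (∑ D f +_) (∑-map (p *_) D f))
    row-u : ∀ {u} → u ∈ D → ∑[ v ∈ R ] 𝟙 (u ∣? v) ≡ S u + S u
    row-u {u} u∈D = trans (∑-R _) (cong (S u +_) (∑-cong D λ {v} _ →
      𝟙-⇔ (∣*⇔∣ p-prime (p∤m ∘ flip ∣-trans (∈-divisors⁻ u∈D))) (u ∣? p * v) (u ∣? v)))
    row-pu : ∀ {u} → u ∈ D → ∑[ v ∈ R ] 𝟙 (p * u ∣? v) ≡ S u
    row-pu {u} _ = trans (∑-R _) (cong₂ _+_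
      (trans (∑-cong D λ v∈D → 𝟙-no (λ pu∣v → p∤m (∣-trans (∣-trans (m∣m*n u) pu∣v) (∈-divisors⁻ v∈D))) _)
             (trans (∑-const D 0) (*-zeroʳ (length D))))
      (∑-cong D λ {v} _ → 𝟙-⇔ (mk⇔ (*-cancelˡ-∣ p) (*-monoʳ-∣ p)) (p * u ∣? p * v) (u ∣? v)))
    x+x+x≡3*x : ∀ x → x + x + x ≡ 3 * x
    x+x+x≡3*x = solve-∀

prime∣prime⇒≡ : ∀ {p q} → Prime p → Prime q → p ∣ q → p ≡ q
prime∣prime⇒≡ p-prime q-prime p∣q with prime⇒irreducible q-prime p∣q
... | inj₁ refl = contradiction p-prime ¬prime[1]
... | inj₂ p≡q  = p≡q

prodFin-nonZero : ∀ {k} (p : Fin k → ℕ) → (∀ i → NonZero (p i)) → NonZero (prodFin p)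
prodFin-nonZero {zero}  p _   = _
prodFin-nonZero {suc k} p p≢0 = m*n≢0 (p zero) _ {{p≢0 zero}} {{prodFin-nonZero (p ∘ suc) (p≢0 ∘ suc)}}

prime∤prodFin : ∀ {k q} (p : Fin k → ℕ) → Prime q → (∀ i → Prime (p i)) → (∀ i → q ≢ p i) →
  ¬ q ∣ prodFin p
prime∤prodFin {zero}  p q-prime _      _   q∣1 = ¬prime[1] (subst Prime (∣1⇒≡1 q∣1) q-prime)
prime∤prodFin {suc k} p q-prime primes q≢p q∣ with euclidsLemma (p zero) (prodFin (p ∘ suc)) q-prime q∣
... | inj₁ q∣p₀   = q≢p zero (prime∣prime⇒≡ q-prime (primes zero) q∣p₀)
... | inj₂ q∣rest = prime∤prodFin (p ∘ suc) q-prime (primes ∘ suc) (q≢p ∘ suc) q∣rest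

module _ {k} (p : Fin (suc k) → ℕ) (primes : ∀ i → Prime (p i)) (p-injective : ∀ i j → p i ≡ p j → i ≡ j) where

  private
    instance
      prodFin-tail≢0 : NonZero (prodFin (p ∘ suc))
      prodFin-tail≢0 = prodFin-nonZero (p ∘ suc) (prime⇒nonZero ∘ primes ∘ suc)

    head∤prodFin-tail : ¬ p zero ∣ prodFin (p ∘ suc)
    head∤prodFin-tail = prime∤prodFin (p ∘ suc) (primes zero) (primes ∘ suc)
      λ i → Fin.0≢1+n ∘ p-injective zero (suc i)

  length-divisors-prodFin-suc : length (divisors (prodFin p)) ≡ 2 * length (divisors (prodFin (p ∘ suc)))
  length-divisors-prodFin-suc = length-divisors-*-prime (primes zero) head∤prodFin-tail

  dividingPairs-prodFin-suc : dividingPairs (prodFin p) ≡ 3 * dividingPairs (prodFin (p ∘ suc))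
  dividingPairs-prodFin-suc = dividingPairs-*-prime (primes zero) head∤prodFin-tail

  tail-injective : ∀ i j → p (suc i) ≡ p (suc j) → i ≡ j
  tail-injective i j = Fin.suc-injective ∘ p-injective (suc i) (suc j)

length-divisors-prodFin : ∀ k (p : Fin k → ℕ) → (∀ i → Prime (p i)) → (∀ i j → p i ≡ p j → i ≡ j) →
  length (divisors (prodFin p)) ≡ 2 ^ k
length-divisors-prodFin zero    p _      _   = refl
length-divisors-prodFin (suc k) p primes inj = trans (length-divisors-prodFin-suc p primes inj)
  (cong (2 *_) (length-divisors-prodFin k (p ∘ suc) (primes ∘ suc) (tail-injective p primes inj)))

dividingPairs-prodFin : ∀ k (p : Fin k → ℕ) → (∀ i → Prime (p i)) → (∀ i j → p i ≡ p j → i ≡ j) →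
  dividingPairs (prodFin p) ≡ 3 ^ k
dividingPairs-prodFin zero    p _      _   = refl
dividingPairs-prodFin (suc k) p primes inj = trans (dividingPairs-prodFin-suc p primes inj)
  (cong (3 *_) (dividingPairs-prodFin k (p ∘ suc) (primes ∘ suc) (tail-injective p primes inj)))

+[m+n]-+n : ∀ m n → ℤ.+ (m + n) - ℤ.+ n ≡ ℤ.+ m
+[m+n]-+n m n = begin
  ℤ.+ (m + n) - ℤ.+ n ≡⟨ m-n≡m⊖n (m + n) n ⟩
  (m + n) ⊖ n         ≡⟨ ⊖-≥ (m≤n+m n m) ⟩
  ℤ.+ (m + n ∸ n)     ≡⟨ cong ℤ.+_ (m+n∸n≡m m n) ⟩
  ℤ.+ m               ∎
  where open ≡-Reasoning

theorem3p3 : (k : ℕ) (p : Fin k → ℕ) → (∀ i → Prime (p i)) → (∀ i j → p i ≡ p j → i ≡ j) →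
    ℤ.+ wiener (divisorGraph (prodFin p)) ≡ ℤ.+ (2 ^ (2 * k)) - ℤ.+ (3 ^ k)
theorem3p3 k p primes inj = begin
  ℤ.+ W                           ≡⟨ +[m+n]-+n W (3 ^ k) ⟨
  ℤ.+ (W + 3 ^ k) - ℤ.+ (3 ^ k)   ≡⟨ cong (λ x → ℤ.+ x - ℤ.+ (3 ^ k)) W+3ᵏ≡4ᵏ ⟩
  ℤ.+ (2 ^ (2 * k)) - ℤ.+ (3 ^ k) ∎
  where
  open ≡-Reasoning
  instance
    prodFin≢0 : NonZero (prodFin p)
    prodFin≢0 = prodFin-nonZero p (prime⇒nonZero ∘ primes)
  W : ℕ
  W = wiener (divisorGraph (prodFin p))
  W+3ᵏ≡4ᵏ : W + 3 ^ k ≡ 2 ^ (2 * k)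
  W+3ᵏ≡4ᵏ = begin
    W + 3 ^ k
      ≡⟨ cong (W +_) (dividingPairs-prodFin k p primes inj) ⟨
    W + dividingPairs (prodFin p)
      ≡⟨ wiener+dividingPairs (prodFin p) ⟩
    length (divisors (prodFin p)) * length (divisors (prodFin p))
      ≡⟨ cong (λ ℓ → ℓ * ℓ) (length-divisors-prodFin k p primes inj) ⟩
    2 ^ k * 2 ^ k
      ≡⟨ ^-distribˡ-+-* 2 k k ⟨
    2 ^ (k + k)
      ≡⟨ cong (λ e → 2 ^ (k + e)) (+-identityʳ k) ⟨
    2 ^ (2 * k)
      ∎
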